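{- Let $X=[n]$ be the disjoint union of sets $X_1$ and $X_2$, and let $F_1,\dots,F_m\subseteq[n]$ be such that the family $\mathcal{F}=\{F_1,\dots,F_m\}$ is an anti-chain. Then $$\sum_{i=1}^m \left(\binom{|X_1|}{|F_i\cap X_1|}\binom{|X_2|}{|F_i\cap X_2|}\right)^{ -1} \le 1+\left\lfloor\frac{n}{2}\right\rfloor.$$
   Context: A family $\mathcal{F}$ of sets is an anti-chain if $A\not\subseteq B$ for any two distinct $A,B\in\mathcal{F}$. Here $[n]=\{1,\dots,n\}$. -}

module Defs where

open import Data.Nat using (ℕ; zero; suc)
open import Data.Fin using (Fin; zero; suc)
open import Data.Integer using (+_)
open import Data.Rational using (ℚ; 0ℚ; _+_; _/_)

-- Reciprocal 1/k of a natural number as a rational.  Convention: 1/0 := 0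
-- (never used in the theorem: the binomial products there are always ≥ 1).
recip : ℕ → ℚ
recip zero    = 0ℚ
recip (suc k) = + 1 / suc k

sumFin : (m : ℕ) → (Fin m → ℚ) → ℚ
sumFin zero    f = 0ℚ
sumFin (suc m) f = f zero + sumFin m (λ i → f (suc i))

-- Write a = ∣X₁∣, b = ∣X₂∣.  As (a C k) · k! (a ∸ k)! = a!, the claim is
--   Σᵢ k₁ᵢ! (a ∸ k₁ᵢ)! · k₂ᵢ! (b ∸ k₂ᵢ)!  ≤  (1 + ⌊n/2⌋) · a! · b!,   kⱼᵢ = ∣Fᵢ ∩ Xⱼ∣,
-- where k! (s ∸ k)! is the number of maximal chains of subsets of an s-set through a fixed
-- k-subset.  Such chains are counted by deletion: a maximal chain of S through F ∩ S with
-- S ⊈ F starts by removing some x ∈ S ─ F.  Deletion induction on S gives the LYM inequality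
-- for the members of the antichain lying in an interval [T, T ∪ S], and then the bound
-- (∣S∣ + 1)! ∣X∣! on the number of pairs (chain of S, chain of X) through the members F ⊆ S ∪ X:
-- the members containing S carry at most ∣S∣! ∣X∣! such pairs by LYM on [S, S ∪ X], the
-- others are counted by deletion.  Taking S to be the smaller of X₁, X₂ gives the factor
-- 1 + min(a, b) ≤ 1 + ⌊n/2⌋.
module Submission where

open import Data.Bool.Base using (if_then_else_)
open import Data.Empty using (⊥-elim)
open import Data.Fin.Base using (Fin; zero; suc)
open import Data.Fin.Properties using (punchInᵢ≢i; any?)
open import Data.Fin.Subset
open import Data.Fin.Subset.Induction using (⊂-wellFounded; Acc; acc)
open import Data.Fin.Subset.Properties
open import Data.Integer.Base using (ℤ)
import Data.Integer.Base as ℤ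
import Data.Integer.Properties as ℤ
open import Data.Integer.Tactic.RingSolver using (solve-∀)
import Data.Nat
open import Data.Nat.Base using (ℕ; zero; suc; _+_; _*_; _∸_; _!; _≤_; _<_; z≤n; s≤s)
open import Data.Nat.Combinatorics using (_C_; nCk≡n!/k![n-k]!; k![n∸k]!∣n!)
open import Data.Nat.DivMod using (_/_; m/n*n≡m; m*n/n≡m; /-monoˡ-≤)
open import Data.Nat.Properties
open import Algebra.Properties.Semiring.Sum +-*-semiring
  using (sum; sum-syntax; sum-cong-≗; sum-remove; sum-replicate-zero; ∑-distrib-+; ∑-comm;
         *-distribˡ-sum; *-distribʳ-sum)
open import Data.Product using (_×_; _,_)
open import Data.Rational.Base using (toℚᵘ) renaming (_≤_ to _≤ℚ_; _/_ to _÷_)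
open import Data.Rational.Properties using (toℚᵘ-fromℚᵘ; toℚᵘ-homo-+; toℚᵘ-cancel-≤)
open import Data.Rational.Unnormalised.Base using (mkℚᵘ)
import Data.Rational.Unnormalised.Base as ℚᵘ
import Data.Rational.Unnormalised.Properties as ℚᵘ
open import Data.Sum using (inj₁; inj₂; [_,_]′)
open import Data.Vec.Base using (_∷_; []; here; there)
open import Data.Vec.Functional using (removeAt)
open import Function.Base using (_∘_; flip)
open import Level using (Level)
open import Relation.Binary.PropositionalEquality
open import Relation.Nullary.Decidable
  using (Dec; yes; no; does; _×-dec_; dec-true; dec-false; decidable-stable)
open import Relation.Nullary.Negation using (¬_)

open import Defs

private variable
  ℓ : Level
  A : Set ℓ
  n m : ℕ
  y : Fin n
  p q r : Subset n

𝟙 : Dec A → ℕ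
𝟙 a? = if does a? then 1 else 0

𝟙*-yes : ∀ (a? : Dec A) c → A → 𝟙 a? * c ≡ c
𝟙*-yes a? c a rewrite dec-true a? a = +-identityʳ c

𝟙*-no : ∀ (a? : Dec A) c → ¬ A → 𝟙 a? * c ≡ 0
𝟙*-no a? c ¬a rewrite dec-false a? ¬a = refl

𝟙*-≤ : ∀ (a? : Dec A) {c d} → (A → c ≤ d) → 𝟙 a? * c ≤ d
𝟙*-≤ (yes a) {c} c≤d = ≤-trans (≤-reflexive (+-identityʳ c)) (c≤d a)
𝟙*-≤ (no  _)     _   = z≤n

∑-mono-≤ : ∀ {f g : Fin n → ℕ} → (∀ i → f i ≤ g i) → ∑[ i < n ] f i ≤ ∑[ i < n ] g i
∑-mono-≤ {zero}  f≤g = z≤n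
∑-mono-≤ {suc n} f≤g = +-mono-≤ (f≤g zero) (∑-mono-≤ (f≤g ∘ suc))

∑-single : ∀ {f : Fin n → ℕ} i → (∀ j → j ≢ i → f j ≡ 0) → ∑[ j < n ] f j ≡ f i
∑-single {suc n} {f} i f≡0 = begin
  sum f                         ≡⟨ sum-remove f ⟩
  f i + sum (removeAt f i)      ≡⟨ cong (f i +_) (sum-cong-≗ (λ j → f≡0 _ (punchInᵢ≢i i j))) ⟩
  f i + sum (λ (_ : Fin n) → 0) ≡⟨ cong (f i +_) (sum-replicate-zero n) ⟩
  f i + 0                       ≡⟨ +-identityʳ (f i) ⟩
  f i                           ∎
  where open ≡-Reasoning

∑∈ : Subset n → (Fin n → ℕ) → ℕ
∑∈ {n} p g = ∑[ x < n ] (𝟙 (x ∈? p) * g x)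

syntax ∑∈ p (λ x → g) = ∑[ x ∈ p ] g

∑∈-const : ∀ (p : Subset n) c → ∑[ x ∈ p ] c ≡ ∣ p ∣ * c
∑∈-const []            c = refl
∑∈-const (inside  ∷ p) c = cong₂ _+_ (+-identityʳ c) (∑∈-const p c)
∑∈-const (outside ∷ p) c = ∑∈-const p c

∑∈-mono-⊆ : ∀ {g h : Fin n → ℕ} → p ⊆ q → (∀ {x} → x ∈ p → g x ≤ h x) →
            ∑[ x ∈ p ] g x ≤ ∑[ x ∈ q ] h x
∑∈-mono-⊆ {p = p} {q} {g} {h} p⊆q g≤h = ∑-mono-≤ λ x → 𝟙*-≤ (x ∈? p) λ x∈p →
  ≤-trans (g≤h x∈p) (≤-reflexive (sym (𝟙*-yes (x ∈? q) (h x) (p⊆q x∈p))))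

∑∈-cong : ∀ {g h : Fin n → ℕ} → (∀ {x} → x ∈ p → g x ≡ h x) → ∑[ x ∈ p ] g x ≡ ∑[ x ∈ p ] h x
∑∈-cong g≡h = ≤-antisym (∑∈-mono-⊆ ⊆-refl (≤-reflexive ∘ g≡h))
                        (∑∈-mono-⊆ ⊆-refl (≤-reflexive ∘ sym ∘ g≡h))

∑∈-distribʳ : ∀ (p : Subset n) (g : Fin n → ℕ) c → (∑[ x ∈ p ] g x) * c ≡ ∑[ x ∈ p ] (g x * c)
∑∈-distribʳ p g c = trans (*-distribʳ-sum c (λ x → 𝟙 (x ∈? p) * g x))
                          (sum-cong-≗ λ x → *-assoc (𝟙 (x ∈? p)) (g x) c)

∑-∑∈-comm : ∀ (p : Subset n) (g : Fin m → Fin n → ℕ) →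
            ∑[ i < m ] (∑[ x ∈ p ] g i x) ≡ ∑[ x ∈ p ] (∑[ i < m ] g i x)
∑-∑∈-comm p g = trans (∑-comm (λ i x → 𝟙 (x ∈? p) * g i x))
                      (sum-cong-≗ λ x → sym (*-distribˡ-sum (𝟙 (x ∈? p)) (λ i → g i x)))

x∈p─q⇒x∉q : ∀ (p q : Subset n) → y ∈ p ─ q → y ∉ q
x∈p─q⇒x∉q (_ ∷ p) (outside ∷ q) (there y∈p─q) (there y∈q) = x∈p─q⇒x∉q p q y∈p─q y∈q
x∈p─q⇒x∉q (_ ∷ p) (inside  ∷ q) (there y∈p─q) (there y∈q) = x∈p─q⇒x∉q p q y∈p─q y∈q

p⊈q⇒Nonempty[p─q] : p ⊈ q → Nonempty (p ─ q)
p⊈q⇒Nonempty[p─q] {p = p} {q} p⊈q with nonempty? (p ─ q)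
... | yes ne  = ne
... | no  ¬ne = ⊥-elim (p⊈q p⊆q)
  where
  p⊆q : p ⊆ q
  p⊆q {x} x∈p = decidable-stable (x ∈? q) (λ x∉q → ¬ne (x , x∈p∧x∉q⇒x∈p─q x∈p x∉q))

x∈p⇒∣p∣≡1+∣p-x∣ : y ∈ p → ∣ p ∣ ≡ suc ∣ p - y ∣
x∈p⇒∣p∣≡1+∣p-x∣ {p = inside  ∷ p} here        = cong (suc ∘ ∣_∣) (sym (p─⊥≡p p))
x∈p⇒∣p∣≡1+∣p-x∣ {p = inside  ∷ p} (there y∈p) = cong suc (x∈p⇒∣p∣≡1+∣p-x∣ y∈p)
x∈p⇒∣p∣≡1+∣p-x∣ {p = outside ∷ p} (there y∈p) = x∈p⇒∣p∣≡1+∣p-x∣ y∈p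

∣p∣≡∣q∩p∣+∣p─q∣ : ∀ (p q : Subset n) → ∣ p ∣ ≡ ∣ q ∩ p ∣ + ∣ p ─ q ∣
∣p∣≡∣q∩p∣+∣p─q∣ []            []            = refl
∣p∣≡∣q∩p∣+∣p─q∣ (inside  ∷ p) (inside  ∷ q) = cong suc (∣p∣≡∣q∩p∣+∣p─q∣ p q)
∣p∣≡∣q∩p∣+∣p─q∣ (inside  ∷ p) (outside ∷ q) =
  trans (cong suc (∣p∣≡∣q∩p∣+∣p─q∣ p q)) (sym (+-suc _ _))
∣p∣≡∣q∩p∣+∣p─q∣ (outside ∷ p) (inside  ∷ q) = ∣p∣≡∣q∩p∣+∣p─q∣ p q
∣p∣≡∣q∩p∣+∣p─q∣ (outside ∷ p) (outside ∷ q) = ∣p∣≡∣q∩p∣+∣p─q∣ p q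

∣p∣+∣q∣≡∣p∪q∣+∣p∩q∣ : ∀ (p q : Subset n) → ∣ p ∣ + ∣ q ∣ ≡ ∣ p ∪ q ∣ + ∣ p ∩ q ∣
∣p∣+∣q∣≡∣p∪q∣+∣p∩q∣ []            []            = refl
∣p∣+∣q∣≡∣p∪q∣+∣p∩q∣ (inside  ∷ p) (inside  ∷ q) =
  cong suc (trans (+-suc _ _) (trans (cong suc (∣p∣+∣q∣≡∣p∪q∣+∣p∩q∣ p q)) (sym (+-suc _ _))))
∣p∣+∣q∣≡∣p∪q∣+∣p∩q∣ (inside  ∷ p) (outside ∷ q) = cong suc (∣p∣+∣q∣≡∣p∪q∣+∣p∩q∣ p q)
∣p∣+∣q∣≡∣p∪q∣+∣p∩q∣ (outside ∷ p) (inside  ∷ q) =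
  trans (+-suc _ _) (cong suc (∣p∣+∣q∣≡∣p∪q∣+∣p∩q∣ p q))
∣p∣+∣q∣≡∣p∪q∣+∣p∩q∣ (outside ∷ p) (outside ∷ q) = ∣p∣+∣q∣≡∣p∪q∣+∣p∩q∣ p q

p∩q≡⊥⇒p∪q≡⊤⇒∣p∣+∣q∣≡n : ∀ {n} {p q : Subset n} → p ∩ q ≡ ⊥ → p ∪ q ≡ ⊤ → ∣ p ∣ + ∣ q ∣ ≡ n
p∩q≡⊥⇒p∪q≡⊤⇒∣p∣+∣q∣≡n {n} {p} {q} p∩q≡⊥ p∪q≡⊤ = begin
  ∣ p ∣ + ∣ q ∣          ≡⟨ ∣p∣+∣q∣≡∣p∪q∣+∣p∩q∣ p q ⟩
  ∣ p ∪ q ∣ + ∣ p ∩ q ∣  ≡⟨ cong₂ (λ s t → ∣ s ∣ + ∣ t ∣) p∪q≡⊤ p∩q≡⊥ ⟩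
  ∣ ⊤ {n} ∣ + ∣ ⊥ {n} ∣  ≡⟨ cong₂ _+_ (∣⊤∣≡n n) (∣⊥∣≡0 n) ⟩
  n + 0                  ≡⟨ +-identityʳ n ⟩
  n                      ∎
  where open ≡-Reasoning

p⊆q⇒q∩p≡p : p ⊆ q → q ∩ p ≡ p
p⊆q⇒q∩p≡p {p = p} {q} p⊆q = ⊆-antisym (p∩q⊆q q p) (λ x∈p → x∈p∩q⁺ (p⊆q x∈p , x∈p))

x∉q⇒q∩[p-x]≡q∩p : y ∉ q → q ∩ (p - y) ≡ q ∩ p
x∉q⇒q∩[p-x]≡q∩p {y = y} {q = q} {p} y∉q = ⊆-antisym
  (λ x∈ → let x∈q , x∈p-y = x∈p∩q⁻ q (p - y) x∈ in x∈p∩q⁺ (x∈q , p─q⊆p p _ x∈p-y))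
  (λ x∈ → let x∈q , x∈p = x∈p∩q⁻ q p x∈ in
          x∈p∩q⁺ (x∈q , x∈p∧x≢y⇒x∈p-y x∈p (λ { refl → y∉q x∈q })))

x∉p⇒p⊆q∪r⇒p⊆q∪[r-x] : y ∉ p → p ⊆ q ∪ r → p ⊆ q ∪ (r - y)
x∉p⇒p⊆q∪r⇒p⊆q∪[r-x] {y = y} {q = q} {r} y∉p p⊆q∪r {x} x∈p with x∈p∪q⁻ q r (p⊆q∪r x∈p)
... | inj₁ x∈q = x∈p∪q⁺ (inj₁ x∈q)
... | inj₂ x∈r = x∈p∪q⁺ (inj₂ (x∈p∧x≢y⇒x∈p-y x∈r (λ { refl → y∉p x∈p })))

p⊆r⇒q⊆r⇒p∪q⊆r : p ⊆ r → q ⊆ r → p ∪ q ⊆ r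
p⊆r⇒q⊆r⇒p∪q⊆r {p = p} {q = q} p⊆r q⊆r x∈p∪q = [ p⊆r , q⊆r ]′ (x∈p∪q⁻ p q x∈p∪q)

deletion-induction : (P : Subset n → Set ℓ) →
                     (∀ S → (∀ {x} → x ∈ S → P (S - x)) → P S) → ∀ S → P S
deletion-induction P step S = go S (⊂-wellFounded S)
  where
  go : ∀ S → Acc _⊂_ S → P S
  go S (acc rec) = step S (λ x∈S → go _ (rec (x∈p⇒p-x⊂p x∈S)))

chains : ℕ → ℕ → ℕ
chains k s = k ! * (s ∸ k) !

chains-diag : ∀ k → chains k k ≡ k !
chains-diag k = trans (cong (λ j → k ! * j !) (n∸n≡0 k)) (*-identityʳ (k !))

chains-+suc : ∀ k d → chains k (k + suc d) ≡ suc d * chains k (k + d)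
chains-+suc k d = begin
  k ! * ((k + suc d) ∸ k) !  ≡⟨ cong (λ j → k ! * j !) (m+n∸m≡n k (suc d)) ⟩
  k ! * (suc d * d !)        ≡⟨ *-comm (k !) _ ⟩
  (suc d * d !) * k !        ≡⟨ *-assoc (suc d) (d !) (k !) ⟩
  suc d * (d ! * k !)        ≡⟨ cong (suc d *_) (*-comm (d !) (k !)) ⟩
  suc d * (k ! * d !)        ≡⟨ cong (λ j → suc d * (k ! * j !)) (m+n∸m≡n k d) ⟨
  suc d * chains k (k + d)   ∎
  where open ≡-Reasoning

C*chains≡! : ∀ {k s} → k ≤ s → (s C k) * chains k s ≡ s !
C*chains≡! {k} {s} k≤s = trans (cong (_* chains k s) (nCk≡n!/k![n-k]! k≤s))
  (m/n*n≡m {{k !* (s ∸ k) !≢0}} (k![n∸k]!∣n! k≤s))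

n*[n∸1]!≤n! : ∀ k → k * (k ∸ 1) ! ≤ k !
n*[n∸1]!≤n! zero    = z≤n
n*[n∸1]!≤n! (suc k) = ≤-refl

chainsThrough : Subset n → Subset n → ℕ
chainsThrough F S = chains (∣ F ∩ S ∣) (∣ S ∣)

chainsThrough-⊆ : ∀ {S F : Subset n} → S ⊆ F → chainsThrough F S ≡ ∣ S ∣ !
chainsThrough-⊆ {S = S} S⊆F =
  trans (cong (λ k → chains k (∣ S ∣)) (cong ∣_∣ (p⊆q⇒q∩p≡p S⊆F))) (chains-diag (∣ S ∣))

chainsThrough-peel : ∀ {S F : Subset n} → S ⊈ F →
                     chainsThrough F S ≡ ∑[ x ∈ S ─ F ] chainsThrough F (S - x)
chainsThrough-peel {S = S} {F} S⊈F with p⊈q⇒Nonempty[p─q] S⊈F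
... | x₀ , x₀∈S─F = begin
  chains f ∣ S ∣                          ≡⟨ cong (chains f) ∣S∣≡f+1+d ⟩
  chains f (f + suc d)                    ≡⟨ chains-+suc f d ⟩
  suc d * chains f (f + d)                ≡⟨ cong (_* chains f (f + d)) ∣S─F∣≡1+d ⟨
  ∣ S ─ F ∣ * chains f (f + d)            ≡⟨ ∑∈-const (S ─ F) _ ⟨
  ∑[ x ∈ S ─ F ] chains f (f + d)         ≡⟨ ∑∈-cong (sym ∘ chainsThrough-S-x) ⟩
  ∑[ x ∈ S ─ F ] chainsThrough F (S - x)  ∎
  where
  open ≡-Reasoning
  f = ∣ F ∩ S ∣
  d = ∣ (S ─ F) - x₀ ∣
  ∣S─F∣≡1+d : ∣ S ─ F ∣ ≡ suc d
  ∣S─F∣≡1+d = x∈p⇒∣p∣≡1+∣p-x∣ x₀∈S─F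
  ∣S∣≡f+1+d : ∣ S ∣ ≡ f + suc d
  ∣S∣≡f+1+d = trans (∣p∣≡∣q∩p∣+∣p─q∣ S F) (cong (f +_) ∣S─F∣≡1+d)
  chainsThrough-S-x : ∀ {x} → x ∈ S ─ F → chainsThrough F (S - x) ≡ chains f (f + d)
  chainsThrough-S-x x∈S─F = cong₂ chains
    (cong ∣_∣ (x∉q⇒q∩[p-x]≡q∩p (x∈p─q⇒x∉q S F x∈S─F)))
    (suc-injective (begin
      suc ∣ S - _ ∣  ≡⟨ x∈p⇒∣p∣≡1+∣p-x∣ (p─q⊆p S F x∈S─F) ⟨
      ∣ S ∣          ≡⟨ ∣S∣≡f+1+d ⟩
      f + suc d      ≡⟨ +-suc f d ⟩
      suc (f + d)    ∎))

Antichain : (Fin m → Subset n) → Set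
Antichain {m} F = ∀ (i j : Fin m) → i ≢ j → F i ⊈ F j

module _ (F : Fin m → Subset n) where

  Between : Subset n → Subset n → Fin m → Set
  Between T S i = T ⊆ F i × F i ⊆ T ∪ S

  between? : ∀ T S i → Dec (Between T S i)
  between? T S i = T ⊆? F i ×-dec F i ⊆? T ∪ S

  lymTerm : Subset n → Subset n → Fin m → ℕ
  lymTerm T S i = 𝟙 (between? T S i) * chainsThrough (F i) S

  -- ∣S∣! times the LYM sum of {F i ∩ S ∣ T ⊆ F i ⊆ T ∪ S}, an antichain in 2^S when F is one.
  lymSum : Subset n → Subset n → ℕ
  lymSum T S = ∑[ i < m ] lymTerm T S i

  lymSum-single : Antichain F → ∀ {T S} i → Between T S i → S ⊆ F i → lymSum T S ≡ ∣ S ∣ !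
  lymSum-single antichain {T} {S} i (T⊆Fi , Fi⊆T∪S) S⊆Fi = begin
    lymSum T S             ≡⟨ ∑-single i others-vanish ⟩
    lymTerm T S i          ≡⟨ 𝟙*-yes (between? T S i) _ (T⊆Fi , Fi⊆T∪S) ⟩
    chainsThrough (F i) S  ≡⟨ chainsThrough-⊆ S⊆Fi ⟩
    ∣ S ∣ !                ∎
    where
    open ≡-Reasoning
    others-vanish : ∀ j → j ≢ i → lymTerm T S j ≡ 0
    others-vanish j j≢i = 𝟙*-no (between? T S j) _ λ (_ , Fj⊆T∪S) →
      antichain j i j≢i (⊆-trans Fj⊆T∪S (p⊆r⇒q⊆r⇒p∪q⊆r T⊆Fi S⊆Fi))

  lymTerm-peel : ∀ T S i → (Between T S i → S ⊈ F i) →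
                 lymTerm T S i ≤ ∑[ x ∈ S ] lymTerm T (S - x) i
  lymTerm-peel T S i S⊈Fi = 𝟙*-≤ (between? T S i) λ (T⊆Fi , Fi⊆T∪S) → begin
    chainsThrough (F i) S                         ≡⟨ chainsThrough-peel (S⊈Fi (T⊆Fi , Fi⊆T∪S)) ⟩
    ∑[ x ∈ S ─ F i ] chainsThrough (F i) (S - x)  ≤⟨ ∑∈-mono-⊆ (p─q⊆p S (F i))
                                                                 (still-between T⊆Fi Fi⊆T∪S) ⟩
    ∑[ x ∈ S ] lymTerm T (S - x) i                ∎
    where
    open ≤-Reasoning
    still-between : T ⊆ F i → F i ⊆ T ∪ S → ∀ {x} → x ∈ S ─ F i →
                    chainsThrough (F i) (S - x) ≤ lymTerm T (S - x) i
    still-between T⊆Fi Fi⊆T∪S x∈S─Fi = ≤-reflexive (sym (𝟙*-yes (between? T (S - _) i) _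
      (T⊆Fi , x∉p⇒p⊆q∪r⇒p⊆q∪[r-x] (x∈p─q⇒x∉q S (F i) x∈S─Fi) Fi⊆T∪S)))

  lymSum-step : Antichain F → ∀ T S → (∀ {x} → x ∈ S → lymSum T (S - x) ≤ ∣ S - x ∣ !) →
                lymSum T S ≤ ∣ S ∣ !
  lymSum-step antichain T S ih with any? (λ i → between? T S i ×-dec S ⊆? F i)
  ... | yes (i , between , S⊆Fi) = ≤-reflexive (lymSum-single antichain i between S⊆Fi)
  ... | no  ∄ = begin
    lymSum T S
      ≤⟨ ∑-mono-≤ (λ i → lymTerm-peel T S i (λ between S⊆Fi → ∄ (i , between , S⊆Fi))) ⟩
    ∑[ i < m ] (∑[ x ∈ S ] lymTerm T (S - x) i)
      ≡⟨ ∑-∑∈-comm S (λ i x → lymTerm T (S - x) i) ⟩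
    ∑[ x ∈ S ] lymSum T (S - x)
      ≤⟨ ∑∈-mono-⊆ ⊆-refl ih′ ⟩
    ∑[ x ∈ S ] ((∣ S ∣ ∸ 1) !)
      ≡⟨ ∑∈-const S _ ⟩
    ∣ S ∣ * (∣ S ∣ ∸ 1) !
      ≤⟨ n*[n∸1]!≤n! (∣ S ∣) ⟩
    ∣ S ∣ ! ∎
    where
    open ≤-Reasoning
    ih′ : ∀ {x} → x ∈ S → lymSum T (S - x) ≤ (∣ S ∣ ∸ 1) !
    ih′ x∈S rewrite x∈p⇒∣p∣≡1+∣p-x∣ x∈S = ih x∈S

  lymSum-≤ : Antichain F → ∀ T S → lymSum T S ≤ ∣ S ∣ !
  lymSum-≤ antichain T = deletion-induction _ (lymSum-step antichain T)

  productTerm : Subset n → Subset n → Fin m → ℕ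
  productTerm S X i = 𝟙 (F i ⊆? X ∪ S) * (chainsThrough (F i) S * chainsThrough (F i) X)

  productSum : Subset n → Subset n → ℕ
  productSum S X = ∑[ i < m ] productTerm S X i

  productTerm-peel : ∀ S X i →
    productTerm S X i ≤ ∣ S ∣ ! * lymTerm S X i + ∑[ x ∈ S ] productTerm (S - x) X i
  productTerm-peel S X i = 𝟙*-≤ (F i ⊆? X ∪ S) (λ Fi⊆X∪S → peel Fi⊆X∪S (S ⊆? F i))
    where
    open ≤-Reasoning
    c = chainsThrough (F i) X
    still-inside : F i ⊆ X ∪ S → ∀ {x} → x ∈ S ─ F i →
                   chainsThrough (F i) (S - x) * c ≤ productTerm (S - x) X i
    still-inside Fi⊆X∪S x∈S─Fi = ≤-reflexive (sym (𝟙*-yes (F i ⊆? X ∪ (S - _)) _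
      (x∉p⇒p⊆q∪r⇒p⊆q∪[r-x] (x∈p─q⇒x∉q S (F i) x∈S─Fi) Fi⊆X∪S)))
    peel : F i ⊆ X ∪ S → Dec (S ⊆ F i) →
           chainsThrough (F i) S * c ≤ ∣ S ∣ ! * lymTerm S X i + ∑[ x ∈ S ] productTerm (S - x) X i
    peel Fi⊆X∪S (yes S⊆Fi) = flip ≤-trans (m≤m+n _ _) (begin
      chainsThrough (F i) S * c  ≡⟨ cong (_* c) (chainsThrough-⊆ S⊆Fi) ⟩
      ∣ S ∣ ! * c                ≡⟨ cong (∣ S ∣ ! *_) (𝟙*-yes (between? S X i) c
                                      (S⊆Fi , subst (F i ⊆_) (∪-comm X S) Fi⊆X∪S)) ⟨
      ∣ S ∣ ! * lymTerm S X i    ∎)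
    peel Fi⊆X∪S (no S⊈Fi) = flip ≤-trans (m≤n+m _ _) (begin
      chainsThrough (F i) S * c
        ≡⟨ cong (_* c) (chainsThrough-peel S⊈Fi) ⟩
      (∑[ x ∈ S ─ F i ] chainsThrough (F i) (S - x)) * c
        ≡⟨ ∑∈-distribʳ (S ─ F i) _ c ⟩
      ∑[ x ∈ S ─ F i ] (chainsThrough (F i) (S - x) * c)
        ≤⟨ ∑∈-mono-⊆ (p─q⊆p S (F i)) (still-inside Fi⊆X∪S) ⟩
      ∑[ x ∈ S ] productTerm (S - x) X i ∎)

  productSum-step : Antichain F → ∀ S X →
    (∀ {x} → x ∈ S → productSum (S - x) X ≤ suc ∣ S - x ∣ ! * ∣ X ∣ !) →
    productSum S X ≤ suc ∣ S ∣ ! * ∣ X ∣ !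
  productSum-step antichain S X ih = begin
    productSum S X
      ≤⟨ ∑-mono-≤ (productTerm-peel S X) ⟩
    ∑[ i < m ] (∣ S ∣ ! * lymTerm S X i + ∑[ x ∈ S ] productTerm (S - x) X i)
      ≡⟨ ∑-distrib-+ (λ i → ∣ S ∣ ! * lymTerm S X i) (λ i → ∑[ x ∈ S ] productTerm (S - x) X i) ⟩
    ∑[ i < m ] (∣ S ∣ ! * lymTerm S X i) + ∑[ i < m ] (∑[ x ∈ S ] productTerm (S - x) X i)
      ≡⟨ cong₂ _+_ (sym (*-distribˡ-sum (∣ S ∣ !) (lymTerm S X)))
                   (∑-∑∈-comm S (λ i x → productTerm (S - x) X i)) ⟩
    ∣ S ∣ ! * lymSum S X + ∑[ x ∈ S ] productSum (S - x) X
      ≤⟨ +-mono-≤ (*-monoʳ-≤ (∣ S ∣ !) (lymSum-≤ antichain S X)) (∑∈-mono-⊆ ⊆-refl ih′) ⟩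
    ∣ S ∣ ! * ∣ X ∣ ! + ∑[ x ∈ S ] (∣ S ∣ ! * ∣ X ∣ !)
      ≡⟨ cong (∣ S ∣ ! * ∣ X ∣ ! +_) (∑∈-const S _) ⟩
    ∣ S ∣ ! * ∣ X ∣ ! + ∣ S ∣ * (∣ S ∣ ! * ∣ X ∣ !)
      ≡⟨ cong (∣ S ∣ ! * ∣ X ∣ ! +_) (*-assoc (∣ S ∣) (∣ S ∣ !) (∣ X ∣ !)) ⟨
    ∣ S ∣ ! * ∣ X ∣ ! + ∣ S ∣ * ∣ S ∣ ! * ∣ X ∣ !
      ≡⟨ *-distribʳ-+ (∣ X ∣ !) (∣ S ∣ !) (∣ S ∣ * ∣ S ∣ !) ⟨
    suc ∣ S ∣ ! * ∣ X ∣ ! ∎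
    where
    open ≤-Reasoning
    ih′ : ∀ {x} → x ∈ S → productSum (S - x) X ≤ ∣ S ∣ ! * ∣ X ∣ !
    ih′ x∈S rewrite x∈p⇒∣p∣≡1+∣p-x∣ x∈S = ih x∈S

  productSum-≤ : Antichain F → ∀ S X → productSum S X ≤ suc ∣ S ∣ ! * ∣ X ∣ !
  productSum-≤ antichain S X = deletion-induction (λ S → productSum S X ≤ suc ∣ S ∣ ! * ∣ X ∣ !)
    (λ S → productSum-step antichain S X) S

  chainPairSum : Subset n → Subset n → ℕ
  chainPairSum X₁ X₂ = ∑[ i < m ] (chainsThrough (F i) X₁ * chainsThrough (F i) X₂)

  chainPairSum-comm : ∀ X₁ X₂ → chainPairSum X₁ X₂ ≡ chainPairSum X₂ X₁
  chainPairSum-comm X₁ X₂ = sum-cong-≗ λ i → *-comm (chainsThrough (F i) X₁) _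

  chainPairSum-≤ : Antichain F → ∀ X₁ X₂ → X₂ ∪ X₁ ≡ ⊤ →
                   chainPairSum X₁ X₂ ≤ suc ∣ X₁ ∣ * (∣ X₁ ∣ ! * ∣ X₂ ∣ !)
  chainPairSum-≤ antichain X₁ X₂ X₂∪X₁≡⊤ = begin
    chainPairSum X₁ X₂
      ≡⟨ sum-cong-≗ (λ i → sym (𝟙*-yes (F i ⊆? X₂ ∪ X₁) _ (subst (F i ⊆_) (sym X₂∪X₁≡⊤) ⊆⊤))) ⟩
    productSum X₁ X₂
      ≤⟨ productSum-≤ antichain X₁ X₂ ⟩
    suc ∣ X₁ ∣ ! * ∣ X₂ ∣ !
      ≡⟨ *-assoc (suc ∣ X₁ ∣) (∣ X₁ ∣ !) (∣ X₂ ∣ !) ⟩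
    suc ∣ X₁ ∣ * (∣ X₁ ∣ ! * ∣ X₂ ∣ !) ∎
    where open ≤-Reasoning

m≤n⇒m≤[m+n]/2 : ∀ {m n} → m ≤ n → m ≤ (m + n) / 2
m≤n⇒m≤[m+n]/2 {m} {n} m≤n = begin
  m            ≡⟨ m*n/n≡m m 2 ⟨
  m * 2 / 2    ≤⟨ /-monoˡ-≤ 2 (≤-trans (≤-reflexive m*2≡m+m) (+-monoʳ-≤ m m≤n)) ⟩
  (m + n) / 2  ∎
  where
  open ≤-Reasoning
  m*2≡m+m : m * 2 ≡ m + m
  m*2≡m+m = trans (*-comm m 2) (cong (m +_) (+-identityʳ m))

chainPairSum-≤-half : ∀ {F : Fin m → Subset n} → Antichain F → ∀ {X₁ X₂} →
  X₁ ∩ X₂ ≡ ⊥ → X₁ ∪ X₂ ≡ ⊤ → chainPairSum F X₁ X₂ ≤ suc (n / 2) * (∣ X₁ ∣ ! * ∣ X₂ ∣ !)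
chainPairSum-≤-half {n = n} {F} antichain {X₁} {X₂} X₁∩X₂≡⊥ X₁∪X₂≡⊤ =
  [ (λ a≤b → ≤-trans bound₁ (half a≤b a+b≡n))
  , (λ b≤a → ≤-trans bound₂ (half b≤a (trans (+-comm b a) a+b≡n))) ]′ (≤-total a b)
  where
  a = ∣ X₁ ∣
  b = ∣ X₂ ∣
  a+b≡n = p∩q≡⊥⇒p∪q≡⊤⇒∣p∣+∣q∣≡n X₁∩X₂≡⊥ X₁∪X₂≡⊤
  half : ∀ {k l} → k ≤ l → k + l ≡ n → suc k * (a ! * b !) ≤ suc (n / 2) * (a ! * b !)
  half {k} k≤l k+l≡n =
    *-monoˡ-≤ (a ! * b !) (s≤s (subst (λ s → k ≤ s / 2) k+l≡n (m≤n⇒m≤[m+n]/2 k≤l)))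
  bound₁ : chainPairSum F X₁ X₂ ≤ suc a * (a ! * b !)
  bound₁ = chainPairSum-≤ F antichain X₁ X₂ (trans (∪-comm X₂ X₁) X₁∪X₂≡⊤)
  bound₂ : chainPairSum F X₁ X₂ ≤ suc b * (a ! * b !)
  bound₂ = begin
    chainPairSum F X₁ X₂  ≡⟨ chainPairSum-comm F X₁ X₂ ⟩
    chainPairSum F X₂ X₁  ≤⟨ chainPairSum-≤ F antichain X₂ X₁ X₁∪X₂≡⊤ ⟩
    suc b * (b ! * a !)   ≡⟨ cong (suc b *_) (*-comm (b !) (a !)) ⟩
    suc b * (a ! * b !)   ∎
    where open ≤-Reasoning

-- Imported only here: in scope with ℕ's _+_, ℤ's +_ would make every section (x +_) ambiguous.
open import Data.Integer.Base using (+_)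

[p*d+q*d]*d≡[p+q]*[d*d] : ∀ (p q d : ℤ) → (p ℤ.* d ℤ.+ q ℤ.* d) ℤ.* d ≡ (p ℤ.+ q) ℤ.* (d ℤ.* d)
[p*d+q*d]*d≡[p+q]*[d*d] = solve-∀

-- mkℚᵘ c D denotes c / (1 + D).
mkℚᵘ-+ : ∀ c c′ D → mkℚᵘ (+ c) D ℚᵘ.+ mkℚᵘ (+ c′) D ℚᵘ.≃ mkℚᵘ (+ (c + c′)) D
mkℚᵘ-+ c c′ D = ℚᵘ.*≡* (trans ([p*d+q*d]*d≡[p+q]*[d*d] (+ c) (+ c′) (+ suc D))
  (cong₂ ℤ._*_ (sym (ℤ.pos-+ c c′)) (sym (ℤ.pos-* (suc D) (suc D)))))

toℚᵘ-recip : ∀ N c {D} → N * c ≡ suc D → toℚᵘ (recip N) ℚᵘ.≃ mkℚᵘ (+ c) D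
toℚᵘ-recip (suc N) c {D} N*c≡1+D = ℚᵘ.≃-trans (toℚᵘ-fromℚᵘ (mkℚᵘ (+ 1) N))
  (ℚᵘ.*≡* (trans (ℤ.*-identityˡ (+ suc D))
    (trans (cong +_ (trans (sym N*c≡1+D) (*-comm (suc N) c))) (ℤ.pos-* c (suc N)))))

toℚᵘ-sumFin-recip : ∀ {N c : Fin m → ℕ} {D} → (∀ i → N i * c i ≡ suc D) →
  toℚᵘ (sumFin m (λ i → recip (N i))) ℚᵘ.≃ mkℚᵘ (+ ∑[ i < m ] c i) D
toℚᵘ-sumFin-recip {zero}              _        = ℚᵘ.*≡* refl
toℚᵘ-sumFin-recip {suc m} {N} {c} {D} N*c≡1+D = ℚᵘ.≃-trans (toℚᵘ-homo-+ (recip (N zero)) _)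
  (ℚᵘ.≃-trans (ℚᵘ.+-cong (toℚᵘ-recip (N zero) (c zero) (N*c≡1+D zero))
                         (toℚᵘ-sumFin-recip {N = N ∘ suc} {c ∘ suc} (N*c≡1+D ∘ suc)))
    (mkℚᵘ-+ (c zero) (∑[ i < m ] c (suc i)) D))

sumFin-recip-≤ : ∀ (N c : Fin m → ℕ) {d} K → 0 < d → (∀ i → N i * c i ≡ d) →
  ∑[ i < m ] c i ≤ K * d → sumFin m (λ i → recip (N i)) ≤ℚ + K ÷ 1
sumFin-recip-≤ {m} N c {suc D} K _ N*c≡d ∑c≤Kd = toℚᵘ-cancel-≤
  (ℚᵘ.≤-respˡ-≃ (ℚᵘ.≃-sym (toℚᵘ-sumFin-recip {N = N} {c} N*c≡d))
    (ℚᵘ.≤-respʳ-≃ (ℚᵘ.≃-sym (toℚᵘ-fromℚᵘ (mkℚᵘ (+ K) 0)))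
      (ℚᵘ.*≤* (begin
        + (∑[ i < m ] c i) ℤ.* + 1  ≡⟨ ℤ.*-identityʳ _ ⟩
        + (∑[ i < m ] c i)          ≤⟨ ℤ.+≤+ ∑c≤Kd ⟩
        + (K * suc D)               ≡⟨ ℤ.pos-* K (suc D) ⟩
        + K ℤ.* + suc D             ∎))))
  where open ℤ.≤-Reasoning

corollary3p3 : (n : ℕ) (X₁ X₂ : Subset n) →
    X₁ ∩ X₂ ≡ ⊥ → X₁ ∪ X₂ ≡ ⊤ →
    (m : ℕ) (F : Fin m → Subset n) →
    (∀ i j → i ≢ j → ¬ (F i ⊆ F j)) →
    sumFin m (λ i → recip ((∣ X₁ ∣ C ∣ F i ∩ X₁ ∣) * (∣ X₂ ∣ C ∣ F i ∩ X₂ ∣)))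
      ≤ℚ (+ (1 Data.Nat.+ n / 2)) ÷ 1
corollary3p3 n X₁ X₂ X₁∩X₂≡⊥ X₁∪X₂≡⊤ m F antichain =
  sumFin-recip-≤ binomials chainPair (1 Data.Nat.+ n / 2) (*-mono-≤ (1≤n! a) (1≤n! b))
    binomials*chainPair≡a!b! (chainPairSum-≤-half antichain X₁∩X₂≡⊥ X₁∪X₂≡⊤)
  where
  a = ∣ X₁ ∣
  b = ∣ X₂ ∣
  binomials chainPair : Fin m → ℕ
  binomials i = (a C ∣ F i ∩ X₁ ∣) * (b C ∣ F i ∩ X₂ ∣)
  chainPair i = chainsThrough (F i) X₁ * chainsThrough (F i) X₂
  binomials*chainPair≡a!b! : ∀ i → binomials i * chainPair i ≡ a ! * b !
  binomials*chainPair≡a!b! i =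
    trans ([m*n]*[o*p]≡[m*o]*[n*p] (a C f₁) (b C f₂) (chains f₁ a) (chains f₂ b))
          (cong₂ _*_ (C*chains≡! (∣p∩q∣≤∣q∣ (F i) X₁)) (C*chains≡! (∣p∩q∣≤∣q∣ (F i) X₂)))
    where
    f₁ = ∣ F i ∩ X₁ ∣
    f₂ = ∣ F i ∩ X₂ ∣
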